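{- Let $G$ be a graph, $k$ a positive integer and $c:E(G)\to[k]$ a $k$-star coloring of $G$. For every graph $H$ and every $k$-edge coloring $c':E(H)\to[k]$, if $D(G^c)=D(H^{c'})$, then $c'$ is a $k$-star coloring of $H$.
   Context: All graphs are finite, undirected, simple and connected. A $k$-edge coloring of $G$ is any function $c:E(G)\to[k]$, $[k]=\{1,\dots,k\}$ (not necessarily proper); $G^c$ denotes $G$ with coloring $c$. For $i\in[k]$, $E_i(G^c)=\{e\in E(G): c(e)=i\}$ and the color-$i$ subgraph $G^c_i$ is the edge-induced subgraph $G[E_i(G^c)]$ (vertex set: union of edges in $E_i(G^c)$; edge set: $E_i(G^c)$). A $k$-star coloring is a $k$-edge coloring such that every color-$i$ subgraph ($i\in[k]$) is a star $K_{1,p}$ for some $p\ge1$. For $v\in V(G)$, the color-$i$ degree $\deg_{G^c}(v,i)$ is the number of edges of color $i$ incident to $v$, the colored degree of $v$ is the tuple $(\deg_{G^c}(v,1),\dots,\deg_{G^c}(v,k))$, and the colored degree set $D(G^c)$ is the multiset of colored degrees of all vertices of $G$. -}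

module Defs where

open import Data.Nat using (ℕ; zero; suc; _+_; _≤_)
open import Data.Fin using (Fin)
open import Data.Product using (Σ; ∃; ∃-syntax; _×_; _,_; proj₁; proj₂)
open import Data.Sum using (_⊎_)
open import Data.List using (List; filter; length; allFin)
open import Relation.Nullary using (¬_; Dec)
open import Relation.Nullary.Decidable using (_⊎-dec_; _×-dec_)
open import Relation.Binary.PropositionalEquality using (_≡_; _≢_)
open import Function.Bundles using (_↔_; Inverse)
import Data.Fin.Properties as FinP

-- A finite simple connected graph: vertices Fin nV, edges Fin nE,
-- each edge has two (ordered, but read as unordered) distinct endpoints,
-- no two edges share the same unordered pair of endpoints.
Adjacent' : ∀ {nV nE} → (Fin nE → Fin nV × Fin nV) → Fin nV → Fin nV → Set
Adjacent' {nE = nE} ends u v =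
  ∃[ e ] ((ends e ≡ (u , v)) ⊎ (ends e ≡ (v , u)))

data Reach {nV nE} (ends : Fin nE → Fin nV × Fin nV) : Fin nV → Fin nV → Set where
  here : ∀ {u} → Reach ends u u
  step : ∀ {u v w} → Adjacent' ends u v → Reach ends v w → Reach ends u w

record Graph : Set where
  field
    nV       : ℕ
    nE       : ℕ
    ends     : Fin nE → Fin nV × Fin nV
    nonempty : 1 ≤ nV
    noLoop   : ∀ e → proj₁ (ends e) ≢ proj₂ (ends e)
    noMulti  : ∀ e e' → (ends e ≡ ends e' ⊎
                         (proj₁ (ends e) ≡ proj₂ (ends e') × proj₂ (ends e) ≡ proj₁ (ends e')))
                      → e ≡ e'
    connected : ∀ u v → Reach ends u v

open Graph public

V : Graph → Set
V G = Fin (nV G)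

E : Graph → Set
E G = Fin (nE G)

-- k-edge colouring (not necessarily proper)
EdgeColoring : Graph → ℕ → Set
EdgeColoring G k = E G → Fin k

IncidentTo : (G : Graph) → V G → E G → Set
IncidentTo G v e = (proj₁ (ends G e) ≡ v) ⊎ (proj₂ (ends G e) ≡ v)

incident? : (G : Graph) → (v : V G) → (e : E G) → Dec (IncidentTo G v e)
incident? G v e = (proj₁ (ends G e) FinP.≟ v) ⊎-dec (proj₂ (ends G e) FinP.≟ v)

colDeg : (G : Graph) {k : ℕ} → EdgeColoring G k → V G → Fin k → ℕ
colDeg G c v i =
  length (filter (λ e → (c e FinP.≟ i) ×-dec incident? G v e) (allFin (nE G)))

-- The colour-i subgraph (edge-induced by E_i) is a star K_{1,p}, p ≥ 1:
-- E_i is nonempty and some vertex (the centre) lies on every edge of E_i.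
-- (In a simple graph, an edge-induced subgraph whose edges all share a common
--  vertex x is exactly K_{1,p} with centre x, p = |E_i|.)
ColorClassIsStar : (G : Graph) {k : ℕ} → EdgeColoring G k → Fin k → Set
ColorClassIsStar G c i =
  (∃[ e ] c e ≡ i) × (∃[ x ] (∀ e → c e ≡ i → IncidentTo G x e))

IsStarColoring : (G : Graph) (k : ℕ) → EdgeColoring G k → Set
IsStarColoring G k c = ∀ i → ColorClassIsStar G c i

-- Equality of the colored degree multisets D(G^c) = D(H^c'):
-- a bijection between vertex sets preserving the colored degree tuple.
SameColoredDegreeSet : (G H : Graph) {k : ℕ} → EdgeColoring G k → EdgeColoring H k → Set
SameColoredDegreeSet G H c c' =
  Σ (V G ↔ V H) λ σ → ∀ v i → colDeg G c v i ≡ colDeg H c' (Inverse.to σ v) i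

module Submission where

-- Fix a colour i.  In G the colour class is a star with some centre y, so
-- (a) every vertex other than y has i-degree at most 1, and
-- (b) the "leaves" (vertices ≠ y of positive i-degree) are at most deg_i(y)
--     many, since distinct leaves lie on distinct i-edges at y.
-- The bijection σ : V G ↔ V H preserves i-degrees, so with x = σ y both facts
-- transfer to H around x.  In H, by (a), sending an i-edge to an endpoint
-- ≠ x is injective into the leaves, hence
--     |E_i(H)| ≤ #leaves(H) ≤ #leaves(G) ≤ deg_i(y) = deg_i(x).
-- The i-edges at x form a subset of E_i(H) of size deg_i(x), so an i-edge
-- missing x would make that subset strictly smaller: every i-edge contains
-- x.  E_i(H) is has-edge because deg_i(x) = deg_i(y) ≥ 1.

open import Defs
open import Data.Nat using (ℕ; suc; _≤_; _<_; s≤s; _≤?_)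
open import Data.Nat.Properties using (≤-trans; ≤-reflexive; n≮n; module ≤-Reasoning)
open import Data.Fin using (Fin; zero; suc; fromℕ<)
open import Data.Fin.Properties using (injective⇒≤) renaming (_≟_ to _≟ᶠ_)
open import Data.Product using (Σ; ∃; _×_; _,_; proj₁; proj₂)
open import Data.Sum using (_⊎_; inj₁; inj₂)
open import Data.Unit using (tt)
open import Data.Empty using (⊥-elim)
open import Data.List using (List; filter; length; allFin; lookup)
import Data.List.Relation.Unary.All as All
open import Data.List.Relation.Unary.AllPairs using (_∷_)
open import Data.List.Relation.Unary.Any using (here; there; index)
open import Data.List.Relation.Unary.Any.Properties using (lookup-index)
open import Data.List.Relation.Unary.Unique.Propositional using (Unique)
open import Data.List.Relation.Unary.Unique.Propositional.Properties using (allFin⁺; filter⁺)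
open import Data.List.Membership.Propositional using (_∈_)
open import Data.List.Membership.Propositional.Properties
  using (∈-filter⁺; ∈-filter⁻; ∈-lookup; ∈-allFin; ∈-length)
open import Relation.Nullary using (yes; no)
open import Relation.Nullary.Decidable using (¬?; _×-dec_)
open import Relation.Unary using (Decidable)
open import Relation.Binary.PropositionalEquality using (_≡_; _≢_; refl; sym; trans; cong; cong₂; subst)
open import Function.Bundles using (_↔_; Inverse)

lookup-injective : ∀ {A : Set} {xs : List A} → Unique xs →
                   ∀ i j → lookup xs i ≡ lookup xs j → i ≡ j
lookup-injective (_ ∷ _)  zero    zero    _  = refl
lookup-injective (x∉ ∷ _) zero    (suc j) eq = ⊥-elim (All.lookup x∉ (∈-lookup j) eq)
lookup-injective (x∉ ∷ _) (suc i) zero    eq = ⊥-elim (All.lookup x∉ (∈-lookup i) (sym eq))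
lookup-injective (_ ∷ u)  (suc i) (suc j) eq = cong suc (lookup-injective u i j eq)

two-members⇒length≥2 : ∀ {A : Set} {x y : A} {xs : List A} →
                       x ∈ xs → y ∈ xs → x ≢ y → 2 ≤ length xs
two-members⇒length≥2 (here refl) (here refl) x≢y = ⊥-elim (x≢y refl)
two-members⇒length≥2 (here refl) (there y∈)  _   = s≤s (∈-length y∈)
two-members⇒length≥2 (there x∈)  _           _   = s≤s (∈-length x∈)

count : ∀ {n} {P : Fin n → Set} → Decidable P → ℕ
count {n} P? = length (filter P? (allFin n))

module _ {n : ℕ} {P : Fin n → Set} (P? : Decidable P) where

  ∈-satisfying : ∀ {j} → P j → j ∈ filter P? (allFin n)
  ∈-satisfying pj = ∈-filter⁺ P? (∈-allFin _) pj

  element : Fin (count P?) → Fin n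
  element k = lookup (filter P? (allFin n)) k

  element-satisfies : ∀ k → P (element k)
  element-satisfies k = proj₂ (∈-filter⁻ P? {xs = allFin n} (∈-lookup k))

  element-injective : ∀ k k' → element k ≡ element k' → k ≡ k'
  element-injective = lookup-injective (filter⁺ P? (allFin⁺ n))

  count-pos : ∀ {j} → P j → 1 ≤ count P?
  count-pos pj = ∈-length (∈-satisfying pj)

  count-witness : 1 ≤ count P? → ∃ P
  count-witness pos = element (fromℕ< pos) , element-satisfies (fromℕ< pos)

  count≤1⇒unique : count P? ≤ 1 → ∀ {a b} → P a → P b → a ≡ b
  count≤1⇒unique ≤1 {a} {b} pa pb with a ≟ᶠ b
  ... | yes a≡b = a≡b
  ... | no  a≢b = ⊥-elim (n≮n 1 (≤-trans
          (two-members⇒length≥2 (∈-satisfying pa) (∈-satisfying pb) a≢b) ≤1))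

module _ {n m : ℕ} {P : Fin n → Set} {Q : Fin m → Set}
         (P? : Decidable P) (Q? : Decidable Q)
         (f : ∀ j → P j → Fin m) (f-into : ∀ j p → Q (f j p))
         (f-injective : ∀ j j' p p' → f j p ≡ f j' p' → j ≡ j') where

  private
    image : ∀ k → f (element P? k) (element-satisfies P? k) ∈ filter Q? (allFin m)
    image k = ∈-satisfying Q? (f-into _ _)

    g : Fin (count P?) → Fin (count Q?)
    g k = index (image k)

    g-spec : ∀ k → f (element P? k) (element-satisfies P? k) ≡ element Q? (g k)
    g-spec k = lookup-index (image k)

    g-injective : ∀ k k' → g k ≡ g k' → k ≡ k'
    g-injective k k' eq = element-injective P? k k' (f-injective _ _ _ _
      (trans (g-spec k) (trans (cong (element Q?) eq) (sym (g-spec k')))))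

  count-≤-injection : count P? ≤ count Q?
  count-≤-injection = injective⇒≤ {f = g} (g-injective _ _)

  count-<-injection : ∀ q → Q q → (∀ j p → f j p ≢ q) → count P? < count Q?
  count-<-injection q Qq missed = injective⇒≤ {f = h} (h-injective _ _)
    where
      q∈ : q ∈ filter Q? (allFin m)
      q∈ = ∈-satisfying Q? Qq

      h : Fin (suc (count P?)) → Fin (count Q?)
      h zero    = index q∈
      h (suc k) = g k

      g-misses-q : ∀ k → g k ≢ index q∈
      g-misses-q k eq = missed _ _
        (trans (g-spec k) (trans (cong (element Q?) eq) (sym (lookup-index q∈))))

      h-injective : ∀ k k' → h k ≡ h k' → k ≡ k'
      h-injective zero    zero     _  = refl
      h-injective zero    (suc k') eq = ⊥-elim (g-misses-q k' (sym eq))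
      h-injective (suc k) zero     eq = ⊥-elim (g-misses-q k eq)
      h-injective (suc k) (suc k') eq = cong suc (g-injective k k' eq)

unique⇒count≤1 : ∀ {n} {P : Fin n → Set} (P? : Decidable P) →
                 (∀ {a b} → P a → P b → a ≡ b) → count P? ≤ 1
unique⇒count≤1 P? unique =
  count-≤-injection P? (λ (_ : Fin 1) → yes tt) (λ _ _ → zero) (λ _ _ → tt)
    (λ _ _ pa pb _ → unique pa pb)

module _ (Γ : Graph) where

  private
    Inc : V Γ → E Γ → Set
    Inc = IncidentTo Γ

  endpoints : ∀ {u w} e → u ≢ w → Inc u e → Inc w e →
              (ends Γ e ≡ (u , w)) ⊎ (ends Γ e ≡ (w , u))
  endpoints e u≢w (inj₁ a) (inj₁ b) = ⊥-elim (u≢w (trans (sym a) b))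
  endpoints e u≢w (inj₁ a) (inj₂ b) = inj₁ (cong₂ _,_ a b)
  endpoints e u≢w (inj₂ a) (inj₁ b) = inj₂ (cong₂ _,_ b a)
  endpoints e u≢w (inj₂ a) (inj₂ b) = ⊥-elim (u≢w (trans (sym a) b))

  -- Two pairs that are reverses of each other, in the form used by noMulti.
  reversed : ∀ {a b : V Γ × V Γ} {s t} → a ≡ (s , t) → b ≡ (t , s) →
             proj₁ a ≡ proj₂ b × proj₂ a ≡ proj₁ b
  reversed refl refl = refl , refl

  edge-determined : ∀ {u w} e e' → u ≢ w →
                    Inc u e → Inc w e → Inc u e' → Inc w e' → e ≡ e'
  edge-determined e e' u≢w u∈e w∈e u∈e' w∈e'
    with endpoints e u≢w u∈e w∈e | endpoints e' u≢w u∈e' w∈e'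
  ... | inj₁ p | inj₁ q = noMulti Γ e e' (inj₁ (trans p (sym q)))
  ... | inj₂ p | inj₂ q = noMulti Γ e e' (inj₁ (trans p (sym q)))
  ... | inj₁ p | inj₂ q = noMulti Γ e e' (inj₂ (reversed p q))
  ... | inj₂ p | inj₁ q = noMulti Γ e e' (inj₂ (reversed p q))

  other-endpoint-unique : ∀ {y v v'} e → Inc y e →
                          Inc v e → v ≢ y → Inc v' e → v' ≢ y → v ≡ v'
  other-endpoint-unique e (inj₁ b) (inj₁ a) v≢y _ _ = ⊥-elim (v≢y (trans (sym a) b))
  other-endpoint-unique e (inj₂ b) (inj₂ a) v≢y _ _ = ⊥-elim (v≢y (trans (sym a) b))
  other-endpoint-unique e _ (inj₁ a) _ (inj₁ a') _ = trans (sym a) a'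
  other-endpoint-unique e _ (inj₂ a) _ (inj₂ a') _ = trans (sym a) a'
  other-endpoint-unique e (inj₂ b) (inj₁ a) _ (inj₂ a') v'≢y = ⊥-elim (v'≢y (trans (sym a') b))
  other-endpoint-unique e (inj₁ b) (inj₂ a) _ (inj₁ a') v'≢y = ⊥-elim (v'≢y (trans (sym a') b))

  endpoint-avoiding : ∀ x (e : E Γ) → Σ (V Γ) λ v → Inc v e × v ≢ x
  endpoint-avoiding x e with proj₁ (ends Γ e) ≟ᶠ x
  ... | yes first≡x = proj₂ (ends Γ e) , inj₂ refl , λ second≡x → noLoop Γ e (trans first≡x (sym second≡x))
  ... | no  first≢x = proj₁ (ends Γ e) , inj₁ refl , first≢x

module ColourClass (Γ : Graph) {k : ℕ} (c : EdgeColoring Γ k) (i : Fin k) where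

  ColouredAt : V Γ → E Γ → Set
  ColouredAt v e = c e ≡ i × IncidentTo Γ v e

  colouredAt? : ∀ v → Decidable (ColouredAt v)
  colouredAt? v e = (c e ≟ᶠ i) ×-dec incident? Γ v e

  deg : V Γ → ℕ
  deg v = colDeg Γ c v i

  coloured? : Decidable (λ e → c e ≡ i)
  coloured? e = c e ≟ᶠ i

  size : ℕ
  size = count coloured?

  CentredAt : V Γ → Set
  CentredAt x = ∀ e → c e ≡ i → IncidentTo Γ x e

  Leaf : V Γ → V Γ → Set
  Leaf x v = v ≢ x × 1 ≤ deg v

  leaf? : ∀ x → Decidable (Leaf x)
  leaf? x v = ¬? (v ≟ᶠ x) ×-dec (1 ≤? deg v)

  leaves : V Γ → ℕ
  leaves x = count (leaf? x)

  centred⇒deg≤1 : ∀ {y w} → CentredAt y → w ≢ y → deg w ≤ 1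
  centred⇒deg≤1 {y} {w} centred w≢y = unique⇒count≤1 (colouredAt? w)
    λ {e} {e'} (ce , w∈e) (ce' , w∈e') →
      edge-determined Γ e e' (λ y≡w → w≢y (sym y≡w)) (centred e ce) w∈e (centred e' ce') w∈e'

  -- Around a centre y, distinct leaves lie on distinct i-edges at y.
  centred⇒leaves≤deg : ∀ {y} → CentredAt y → leaves y ≤ deg y
  centred⇒leaves≤deg {y} centred =
    count-≤-injection (leaf? y) (colouredAt? y) edgeAt
      (λ v leaf → let ce = proj₁ (edgeAt-spec v leaf) in ce , centred _ ce)
      (λ v v' leaf leaf' same → other-endpoint-unique Γ (edgeAt v leaf)
         (centred _ (proj₁ (edgeAt-spec v leaf)))
         (proj₂ (edgeAt-spec v leaf)) (proj₁ leaf)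
         (subst (IncidentTo Γ v') (sym same) (proj₂ (edgeAt-spec v' leaf'))) (proj₁ leaf'))
    where
      edgeAt : ∀ v → Leaf y v → E Γ
      edgeAt v leaf = proj₁ (count-witness (colouredAt? v) (proj₂ leaf))

      edgeAt-spec : ∀ v leaf → ColouredAt v (edgeAt v leaf)
      edgeAt-spec v leaf = proj₂ (count-witness (colouredAt? v) (proj₂ leaf))

  -- If all vertices but x meet at most one i-edge, then each i-edge is
  -- identified by its endpoint other than x, which is a leaf.
  deg≤1⇒size≤leaves : ∀ {x} → (∀ w → w ≢ x → deg w ≤ 1) → size ≤ leaves x
  deg≤1⇒size≤leaves {x} deg≤1 =
    count-≤-injection coloured? (leaf? x) (λ e _ → away e)
      (λ e ce → away-avoids e , count-pos (colouredAt? (away e)) (ce , away-on e))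
      (λ e e' ce ce' same → count≤1⇒unique (colouredAt? (away e))
         (deg≤1 _ (away-avoids e))
         (ce , away-on e)
         (ce' , subst (λ w → IncidentTo Γ w e') (sym same) (away-on e')))
    where
      away : E Γ → V Γ
      away e = proj₁ (endpoint-avoiding Γ x e)

      away-on : ∀ e → IncidentTo Γ (away e) e
      away-on e = proj₁ (proj₂ (endpoint-avoiding Γ x e))

      away-avoids : ∀ e → away e ≢ x
      away-avoids e = proj₂ (proj₂ (endpoint-avoiding Γ x e))

  -- The i-edges at x are among all i-edges; if x already meets |E_i| of
  -- them, an i-edge avoiding x would make the inclusion strict.
  size≤deg⇒centred : ∀ {x} → size ≤ deg x → CentredAt x
  size≤deg⇒centred {x} size≤deg e ce with incident? Γ x e
  ... | yes x∈e = x∈e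
  ... | no  x∉e = ⊥-elim (n≮n (deg x) (≤-trans
          (count-<-injection (colouredAt? x) coloured? (λ e _ → e) (λ _ → proj₁)
             (λ _ _ _ _ eq → eq) e ce (λ e' at eq → x∉e (subst (IncidentTo Γ x) eq (proj₂ at))))
          size≤deg))

module Transfer (G H : Graph) {k : ℕ} (c : EdgeColoring G k) (c' : EdgeColoring H k)
                (σ : V G ↔ V H) (pres : ∀ v i → colDeg G c v i ≡ colDeg H c' (Inverse.to σ v) i)
                (i : Fin k) where

  open Inverse σ using (to; from; strictlyInverseˡ)
  module CG = ColourClass G c i
  module CH = ColourClass H c' i

  deg-from : ∀ w → CH.deg w ≡ CG.deg (from w)
  deg-from w = trans (cong CH.deg (sym (strictlyInverseˡ w))) (sym (pres (from w) i))

  from-avoids : ∀ {y w} → w ≢ to y → from w ≢ y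
  from-avoids {y} {w} w≢σy from-w≡y = w≢σy (trans (sym (strictlyInverseˡ w)) (cong to from-w≡y))

  -- from maps the leaves around σ y injectively to the leaves around y.
  leaves-transfer : ∀ y → CH.leaves (to y) ≤ CG.leaves y
  leaves-transfer y = count-≤-injection (CH.leaf? (to y)) (CG.leaf? y) (λ w _ → from w)
    (λ w (w≢σy , pos) → from-avoids w≢σy , ≤-trans pos (≤-reflexive (deg-from w)))
    (λ w w' _ _ eq → trans (sym (strictlyInverseˡ w)) (trans (cong to eq) (strictlyInverseˡ w')))

  deg≤1-transfer : ∀ {y} → CG.CentredAt y → ∀ w → w ≢ to y → CH.deg w ≤ 1
  deg≤1-transfer centred w w≢σy =
    ≤-trans (≤-reflexive (deg-from w)) (CG.centred⇒deg≤1 centred (from-avoids w≢σy))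

  star-transfer : ColorClassIsStar G c i → ColorClassIsStar H c' i
  star-transfer ((e , ce) , y , centred) = has-edge , to y , CH.size≤deg⇒centred size≤deg
    where
      open ≤-Reasoning

      size≤deg : CH.size ≤ CH.deg (to y)
      size≤deg = begin
        CH.size          ≤⟨ CH.deg≤1⇒size≤leaves (deg≤1-transfer centred) ⟩
        CH.leaves (to y) ≤⟨ leaves-transfer y ⟩
        CG.leaves y      ≤⟨ CG.centred⇒leaves≤deg centred ⟩
        CG.deg y         ≡⟨ pres y i ⟩
        CH.deg (to y)    ∎

      has-edge : ∃ λ e' → c' e' ≡ i
      has-edge with count-witness (CH.colouredAt? (to y))
                      (≤-trans (count-pos (CG.colouredAt? y) (ce , centred e ce)) (≤-reflexive (pres y i)))
      ... | e' , ce' , _ = e' , ce'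

corollary2 : (G : Graph) (k : ℕ) → 1 ≤ k → (c : EdgeColoring G k) →
    IsStarColoring G k c →
    (H : Graph) (c' : EdgeColoring H k) →
    SameColoredDegreeSet G H c c' →
    IsStarColoring H k c'
corollary2 G k _ c star H c' (σ , pres) i = Transfer.star-transfer G H c c' σ pres i (star i)
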